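{- Let $\lambda$ be a partition with at most $n$ parts and $\beta\in U_\lambda(n)$. There exists an upper flag $\varphi\in UF_\lambda(n)$ with $\mathcal{S}_\lambda(\beta)=\mathcal{S}_\lambda(\varphi)$ if and only if $\beta\in UGC_\lambda(n)$. Moreover, when $\beta\in UGC_\lambda(n)$ one has $\mathcal{S}_\lambda(\beta)=\mathcal{S}_\lambda(\varphi)$ for $\varphi:=\Phi_\lambda[\Delta_\lambda(\beta)]$.
   Context: Fix $n\ge1$, $[n]=\{1,\dots,n\}$. A partition $\lambda=(\lambda_1\ge\dots\ge\lambda_n\ge0)$ has shape with rows of lengths $\lambda_i$; box $(j,i)$ is in column $j$, row $i$. $R_\lambda\subseteq[n-1]$ is the set of distinct column lengths of $\lambda$ that are less than $n$, written $q_1<\dots<q_r$, with $q_0:=0$, $q_{r+1}:=n$; for $h\in[r+1]$ the $h$-th carrel is $(q_{h-1},q_h]=\{q_{h-1}+1,\dots,q_h\}$. A $\lambda$-tuple is an $n$-tuple with entries in $[n]$ considered with these carrels; upper if $\beta_i\ge i$ for all $i$. $U_\lambda(n)$: upper $\lambda$-tuples; $UF_\lambda(n)$: weakly increasing ones; $UI_\lambda(n)$: those strictly increasing on each carrel. Critical list of $\beta\in U_\lambda(n)$: in carrel $h$ put $x_1:=q_h$; recursively let $x_u$ be the largest index with $q_{h-1}<x_u<x_{u-1}$ and $\beta_{x_{u-1}}-\beta_{x_u}>x_{u-1}-x_u$, stopping when none exists; these are the critical indices, with critical entries $\beta_{x_u}$. $\lambda$-core: $\Delta_\lambda(\beta)_i:=\beta_x-(x-i)$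 where $x$ is the smallest critical index $\ge i$ in the carrel of $i$. $UGC_\lambda(n)$: those $\beta\in U_\lambda(n)$ whose critical entries, listed by increasing critical index, weakly increase. $UG_\lambda(n):=UGC_\lambda(n)\cap UI_\lambda(n)$. $\lambda$-floor map: for $\gamma\in UG_\lambda(n)$, $\Phi_\lambda(\gamma)=\tau$ where $\tau_x=\gamma_x$ at every critical index $x$ of $\gamma$, and for a non-critical index $i$, with $x$ the smallest critical index $\ge i$ in the carrel of $i$: if $i$ lies in carrel $h+1$ for some $h\in[r]$ and $x$ is the smallest critical index of that carrel, $\tau_i:=\max\{\gamma_{q_h},\gamma_x-(x-i)\}$; otherwise $\tau_i:=\gamma_x-(x-i)$. Tableaux: $\mathcal{T}_\lambda$ is the set of semistandard tableaux of shape $\lambda$ with entries in $[n]$ (strictly increasing down columns, weakly increasing along rows); $T_j(i)$ is the entry in box $(j,i)$. Row bound set: $\mathcal{S}_\lambda(\beta):=\{T\in\mathcal{T}_\lambda: T_j(i)\le\beta_i\text{ for every box }(j,i)\}$. -}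

module Defs where

open import Data.Nat using (ℕ; zero; suc; _+_; _∸_; _≤_; _<_; _⊓_; _⊔_; _≡ᵇ_; _<ᵇ_; _≤ᵇ_)
open import Data.Bool using (Bool; true; false; if_then_else_; _∧_)
open import Data.List using (List; []; _∷_; map; foldr; upTo; _++_; concat; reverse; length; zip)
open import Data.Bool.ListAction using (any)
open import Data.List.Relation.Unary.Linked using (Linked)
open import Data.Product using (_×_; proj₁; proj₂)

-- Conventions: everything is 1-indexed.  An n-tuple is a function ℕ → ℕ of
-- which only the values at indices 1..n matter.  A partition with at most n
-- parts is a function p : ℕ → ℕ with p 1 ≥ p 2 ≥ … ≥ p n (values at other
-- indices are ignored).  A tableau is T : ℕ → ℕ → ℕ, T j i = entry in box
-- (column j, row i); only values in boxes of the shape matter.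

Tuple : Set
Tuple = ℕ → ℕ

oneTo : ℕ → List ℕ
oneTo m = map suc (upTo m)

filterB : (ℕ → Bool) → List ℕ → List ℕ
filterB f [] = []
filterB f (x ∷ xs) = if f x then x ∷ filterB f xs else filterB f xs

IsPartition : ℕ → (ℕ → ℕ) → Set
IsPartition n p = ∀ i → 1 ≤ i → i < n → p (suc i) ≤ p i

colLen : ℕ → (ℕ → ℕ) → ℕ → ℕ
colLen n p j = length (filterB (λ i → j ≤ᵇ p i) (oneTo n))

isR : ℕ → (ℕ → ℕ) → ℕ → Bool
isR n p q = (1 ≤ᵇ q) ∧ ((q <ᵇ n) ∧ any (λ j → colLen n p j ≡ᵇ q) (oneTo (p 1)))

Rlist : ℕ → (ℕ → ℕ) → List ℕ
Rlist n p = filterB (isR n p) (oneTo n)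

-- the carrels (q_{h-1}, q_h], h = 1..r+1, as pairs (q_{h-1}, q_h)
carrels : ℕ → (ℕ → ℕ) → List (ℕ × ℕ)
carrels n p = zip (0 ∷ Rlist n p) (Rlist n p ++ (n ∷ []))

-- for i ∈ [n], the carrel of i is (lo i, hi i]
lo : ℕ → (ℕ → ℕ) → ℕ → ℕ
lo n p i = foldr _⊔_ 0 (filterB (λ q → q <ᵇ i) (Rlist n p))

hi : ℕ → (ℕ → ℕ) → ℕ → ℕ
hi n p i = foldr _⊓_ n (filterB (λ q → i ≤ᵇ q) (Rlist n p))

-- scan β a c x : the critical indices below the critical index c in the
-- carrel (a, _], scanning candidates x, x-1, …, a+1.  Candidate y follows
-- c iff β_c - β_y > c - y, i.e. β_y + c < β_c + y.
scan : Tuple → ℕ → ℕ → ℕ → List ℕ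
scan β a c zero = []
scan β a c (suc x) =
  if suc x ≤ᵇ a then []
  else (if β (suc x) + c <ᵇ β c + suc x
        then suc x ∷ scan β a (suc x) x
        else scan β a c x)

critsC : Tuple → ℕ → ℕ → List ℕ
critsC β a b = b ∷ scan β a b (b ∸ 1)

critList : ℕ → (ℕ → ℕ) → Tuple → List ℕ
critList n p β =
  concat (map (λ ab → reverse (critsC β (proj₁ ab) (proj₂ ab))) (carrels n p))

critsOf : ℕ → (ℕ → ℕ) → Tuple → ℕ → List ℕ
critsOf n p β i = critsC β (lo n p i) (hi n p i)

nextCrit : ℕ → (ℕ → ℕ) → Tuple → ℕ → ℕ
nextCrit n p β i = foldr _⊓_ (hi n p i) (filterB (λ y → i ≤ᵇ y) (critsOf n p β i))

minCrit : ℕ → (ℕ → ℕ) → Tuple → ℕ → ℕ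
minCrit n p β i = foldr _⊓_ (hi n p i) (critsOf n p β i)

isCrit : ℕ → (ℕ → ℕ) → Tuple → ℕ → Bool
isCrit n p β i = any (λ y → y ≡ᵇ i) (critsOf n p β i)

InU : ℕ → Tuple → Set
InU n β = ∀ i → 1 ≤ i → i ≤ n → (i ≤ β i) × (β i ≤ n)

InUF : ℕ → Tuple → Set
InUF n φ = InU n φ × (∀ i → 1 ≤ i → i < n → φ i ≤ φ (suc i))

InUGC : ℕ → (ℕ → ℕ) → Tuple → Set
InUGC n p β = InU n β × Linked _≤_ (map β (critList n p β))

core : ℕ → (ℕ → ℕ) → Tuple → Tuple
core n p β i = β (nextCrit n p β i) ∸ (nextCrit n p β i ∸ i)

floor : ℕ → (ℕ → ℕ) → Tuple → Tuple
floor n p γ i =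
  if isCrit n p γ i then γ i
  else (if (0 <ᵇ lo n p i) ∧ (x ≡ᵇ minCrit n p γ i)
        then γ (lo n p i) ⊔ (γ x ∸ (x ∸ i))
        else γ x ∸ (x ∸ i))
  where
  x : ℕ
  x = nextCrit n p γ i

Tableau : Set
Tableau = ℕ → ℕ → ℕ

InShape : ℕ → (ℕ → ℕ) → ℕ → ℕ → Set
InShape n p j i = (1 ≤ i) × (i ≤ n) × (1 ≤ j) × (j ≤ p i)

IsSSYT : ℕ → (ℕ → ℕ) → Tableau → Set
IsSSYT n p T =
  (∀ j i → InShape n p j i → (1 ≤ T j i) × (T j i ≤ n)) ×
  (∀ j i → 1 ≤ j → InShape n p (suc j) i → T j i ≤ T (suc j) i) ×
  (∀ j i → 1 ≤ i → InShape n p j (suc i) → T j i < T j (suc i))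

InS : ℕ → (ℕ → ℕ) → Tuple → Tableau → Set
InS n p β T = IsSSYT n p T × (∀ j i → InShape n p j i → T j i ≤ β i)

SameS : ℕ → (ℕ → ℕ) → Tuple → Tuple → Set
SameS n p β φ = ∀ T → (InS n p β T → InS n p φ T) × (InS n p φ T → InS n p β T)

-- Fitting v at row i of a column of length c under the row bounds β means v − i ≤ β k − k for all
-- i ≤ k ≤ c, so S_λ(β) only sees the minima of the offset i ↦ β i − i over intervals [i, c] with c a
-- column length, i.e. a carrel end.  Within a carrel these minima are attained at the critical indices,
-- which are the strict suffix minima of the offset.  Passing to the core (which takes the offset of the
-- next critical index), to the core of the core, and through the floor map (which only raises entries
-- and fixes the critical ones) leaves all of them unchanged; if critical entries increase, the floor of
-- the core is moreover weakly increasing.  Conversely the fits in the column ending at a carrel end pin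
-- down β at critical indices, so a flag with the same row bound set agrees with β there, and the
-- critical entries of β inherit its monotonicity.

module Submission where

open import Data.Bool using (Bool; true; false; T; if_then_else_; _∧_)
open import Data.Bool.Properties using (T-∧; T-≡)
open import Data.Empty using (⊥-elim)
open import Data.List using (List; []; _∷_; map; foldr; filterᵇ; concat; reverse; zip; _++_; length; upTo)
open import Data.List.Membership.Propositional using (_∈_; find; lose)
open import Data.List.Membership.Propositional.Properties
  using (∈-filter⁺; ∈-filter⁻; ∈-map⁺; ∈-map⁻; ∈-upTo⁺; ∈-upTo⁻; ∈-concat⁺; ∈-concat⁻)
open import Data.List.Properties using (length-map; map-applyUpTo; length-filter; length-upTo; unfold-reverse)
open import Data.List.Relation.Unary.All using (All; []; _∷_)
import Data.List.Relation.Unary.All as All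
import Data.List.Relation.Unary.All.Properties as All
open import Data.List.Relation.Unary.AllPairs using (AllPairs; []; _∷_)
import Data.List.Relation.Unary.AllPairs.Properties as AllPairs
open import Data.List.Relation.Unary.Any using (here; there)
import Data.List.Relation.Unary.Any.Properties as Any
open import Data.List.Relation.Unary.Linked using (Linked)
import Data.List.Relation.Unary.Linked.Properties as Linked
open import Data.Nat
open import Data.Nat.Properties
open import Algebra.Properties.CommutativeSemigroup +-commutativeSemigroup using (xy∙z≈xz∙y)
open import Data.Nat.Tactic.RingSolver using (solve-∀)
open import Data.Product using (_×_; _,_; proj₁; proj₂; ∃)
open import Data.Sum using (_⊎_; inj₁; inj₂; map₂)
open import Function using (_∘_; Equivalence)
open import Relation.Binary.PropositionalEquality
open import Relation.Nullary using (¬_; yes; no)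
open import Relation.Nullary.Decidable using (T?)
open import Relation.Nullary.Reflects using (ofʸ; ofⁿ)

open import Defs

filterB≡filterᵇ : ∀ (f : ℕ → Bool) xs → filterB f xs ≡ filterᵇ f xs
filterB≡filterᵇ f [] = refl
filterB≡filterᵇ f (x ∷ xs) with f x
... | true = cong (x ∷_) (filterB≡filterᵇ f xs)
... | false = filterB≡filterᵇ f xs

∈-filterB⁺ : ∀ {f x xs} → x ∈ xs → T (f x) → x ∈ filterB f xs
∈-filterB⁺ {f} {xs = xs} x∈xs fx rewrite filterB≡filterᵇ f xs = ∈-filter⁺ (T? ∘ f) x∈xs fx

∈-filterB⁻ : ∀ {f x} xs → x ∈ filterB f xs → x ∈ xs × T (f x)
∈-filterB⁻ {f} xs x∈ rewrite filterB≡filterᵇ f xs = ∈-filter⁻ (T? ∘ f) x∈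

AllPairs-filterB : ∀ {R : ℕ → ℕ → Set} f {xs} → AllPairs R xs → AllPairs R (filterB f xs)
AllPairs-filterB f {xs} rs rewrite filterB≡filterᵇ f xs = AllPairs.filter⁺ (T? ∘ f) rs

foldr-⊓-≤-init : ∀ d xs → foldr _⊓_ d xs ≤ d
foldr-⊓-≤-init d [] = ≤-refl
foldr-⊓-≤-init d (x ∷ xs) = ≤-trans (m⊓n≤n x _) (foldr-⊓-≤-init d xs)

foldr-⊓-≤-∈ : ∀ d {y} xs → y ∈ xs → foldr _⊓_ d xs ≤ y
foldr-⊓-≤-∈ d (x ∷ xs) (here refl) = m⊓n≤m x _
foldr-⊓-≤-∈ d (x ∷ xs) (there y∈) = ≤-trans (m⊓n≤n x _) (foldr-⊓-≤-∈ d xs y∈)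

foldr-⊓-sel : ∀ d xs → foldr _⊓_ d xs ≡ d ⊎ foldr _⊓_ d xs ∈ xs
foldr-⊓-sel d [] = inj₁ refl
foldr-⊓-sel d (x ∷ xs) with ⊓-sel x (foldr _⊓_ d xs) | foldr-⊓-sel d xs
... | inj₁ eq | _ = inj₂ (here eq)
... | inj₂ eq | inj₁ eq′ = inj₁ (trans eq eq′)
... | inj₂ eq | inj₂ m∈ = inj₂ (there (subst (_∈ xs) (sym eq) m∈))

∈⇒≤-foldr-⊔ : ∀ {y} xs → y ∈ xs → y ≤ foldr _⊔_ 0 xs
∈⇒≤-foldr-⊔ (x ∷ xs) (here refl) = m≤m⊔n x _
∈⇒≤-foldr-⊔ (x ∷ xs) (there y∈) = ≤-trans (∈⇒≤-foldr-⊔ xs y∈) (m≤n⊔m x _)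

foldr-⊔-sel : ∀ xs → foldr _⊔_ 0 xs ≡ 0 ⊎ foldr _⊔_ 0 xs ∈ xs
foldr-⊔-sel [] = inj₁ refl
foldr-⊔-sel (x ∷ xs) with ⊔-sel x (foldr _⊔_ 0 xs) | foldr-⊔-sel xs
... | inj₁ eq | _ = inj₂ (here eq)
... | inj₂ eq | inj₁ eq′ = inj₁ (trans eq eq′)
... | inj₂ eq | inj₂ m∈ = inj₂ (there (subst (_∈ xs) (sym eq) m∈))

∈-oneTo⁺ : ∀ {n i} → 1 ≤ i → i ≤ n → i ∈ oneTo n
∈-oneTo⁺ {i = suc i} _ i≤n = ∈-map⁺ suc (∈-upTo⁺ i≤n)

∈-oneTo⁻ : ∀ {n i} → i ∈ oneTo n → 1 ≤ i × i ≤ n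
∈-oneTo⁻ i∈ with ∈-map⁻ suc i∈
... | _ , j∈ , refl = s≤s z≤n , ∈-upTo⁻ j∈

AllPairs-reverse : ∀ {R : ℕ → ℕ → Set} xs → AllPairs R xs → AllPairs (λ x y → R y x) (reverse xs)
AllPairs-reverse [] [] = []
AllPairs-reverse (x ∷ xs) (Rx ∷ Rxs) = subst (AllPairs _) (sym (unfold-reverse x xs))
  (AllPairs.++⁺ (AllPairs-reverse xs Rxs) ([] ∷ []) (All.tabulate (λ y∈ → All.lookup Rx (Any.reverse⁻ y∈) ∷ [])))

module _ {R : ℕ → ℕ → Set} where

  AllPairs-⁺ : ∀ {xs} → AllPairs _<_ xs → (∀ {u v} → u ∈ xs → v ∈ xs → u < v → R u v) → AllPairs R xs
  AllPairs-⁺ [] _ = []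
  AllPairs-⁺ (x<xs ∷ sorted) r =
    All.tabulate (λ v∈ → r (here refl) (there v∈) (All.lookup x<xs v∈)) ∷
    AllPairs-⁺ sorted (λ u∈ v∈ → r (there u∈) (there v∈))

  AllPairs-⁻ : ∀ {xs} → AllPairs _<_ xs → AllPairs R xs → ∀ {u v} → u ∈ xs → v ∈ xs → u < v → R u v
  AllPairs-⁻ _ _ (here refl) (here refl) u<u = ⊥-elim (<-irrefl refl u<u)
  AllPairs-⁻ _ (r ∷ _) (here refl) (there v∈) _ = All.lookup r v∈
  AllPairs-⁻ (x<xs ∷ _) _ (there u∈) (here refl) x<u = ⊥-elim (<-asym x<u (All.lookup x<xs u∈))
  AllPairs-⁻ (_ ∷ sorted) (_ ∷ rs) (there u∈) (there v∈) u<v = AllPairs-⁻ sorted rs u∈ v∈ u<v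

Monotone-on : (ℕ → ℕ) → List ℕ → Set
Monotone-on β xs = ∀ {u v} → u ∈ xs → v ∈ xs → u < v → β u ≤ β v

module _ (β : ℕ → ℕ) {xs} (sorted : AllPairs _<_ xs) where

  Linked-map⇒Monotone-on : Linked _≤_ (map β xs) → Monotone-on β xs
  Linked-map⇒Monotone-on linked =
    AllPairs-⁻ {R = λ u v → β u ≤ β v} sorted (AllPairs.map⁻ (Linked.Linked⇒AllPairs ≤-trans linked))

  Monotone-on⇒Linked-map : Monotone-on β xs → Linked _≤_ (map β xs)
  Monotone-on⇒Linked-map mono =
    Linked.AllPairs⇒Linked (AllPairs.map⁺ (AllPairs-⁺ {R = λ u v → β u ≤ β v} sorted mono))

-- Column lengths

count : (ℕ → Bool) → ℕ → ℕ
count f n = length (filterB f (oneTo n))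

filterB-map-suc : ∀ f xs → filterB f (map suc xs) ≡ map suc (filterB (f ∘ suc) xs)
filterB-map-suc f [] = refl
filterB-map-suc f (x ∷ xs) with f (suc x)
... | true = cong (suc x ∷_) (filterB-map-suc f xs)
... | false = filterB-map-suc f xs

count-shift : ∀ f n → length (filterB f (map suc (map suc (upTo n)))) ≡ count (f ∘ suc) n
count-shift f n = trans (cong length (filterB-map-suc f (oneTo n))) (length-map suc (filterB (f ∘ suc) (oneTo n)))

count-suc : ∀ f n → count f (suc n) ≡ (if f 1 then suc (count (f ∘ suc) n) else count (f ∘ suc) n)
count-suc f n rewrite sym (map-applyUpTo (λ i → i) suc n) with f 1
... | true = cong suc (count-shift f n)
... | false = count-shift f n

DownClosed : (ℕ → Bool) → ℕ → Set
DownClosed f n = ∀ i → 1 ≤ i → i < n → T (f (suc i)) → T (f i)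

count≤ : ∀ f n → count f n ≤ n
count≤ f n = begin
  count f n                        ≡⟨ cong length (filterB≡filterᵇ f (oneTo n)) ⟩
  length (filterᵇ f (oneTo n))     ≤⟨ length-filter (T? ∘ f) (oneTo n) ⟩
  length (oneTo n)                 ≡⟨ length-map suc (upTo n) ⟩
  length (upTo n)                  ≡⟨ length-upTo n ⟩
  n                                ∎
  where open ≤-Reasoning

count-downClosed : ∀ f n → DownClosed f n →
                   ∀ i → 1 ≤ i → i ≤ n → (T (f i) → i ≤ count f n) × (i ≤ count f n → T (f i))
count-downClosed f zero dc i 1≤i i≤0 = ⊥-elim (<⇒≱ 1≤i i≤0)
count-downClosed f (suc m) dc i 1≤i i≤n rewrite count-suc f m = go i 1≤i i≤n
  where
  g = f ∘ suc
  ih : ∀ i → 1 ≤ i → i ≤ m → (T (g i) → i ≤ count g m) × (i ≤ count g m → T (g i))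
  ih = count-downClosed g m (λ i 1≤i i<m → dc (suc i) (s≤s z≤n) (s≤s i<m))
  g-empty : f 1 ≡ false → ¬ (1 ≤ count g m)
  g-empty f1 le = subst T f1 (dc 1 ≤-refl (s≤s 1≤m) (proj₂ (ih 1 ≤-refl 1≤m) le))
    where 1≤m = ≤-trans le (count≤ g m)
  go : ∀ i → 1 ≤ i → i ≤ suc m →
       (T (f i) → i ≤ (if f 1 then suc (count g m) else count g m)) ×
       (i ≤ (if f 1 then suc (count g m) else count g m) → T (f i))
  go i 1≤i i≤n with f 1 in f1
  go (suc zero) _ _ | true = (λ _ → s≤s z≤n) , (λ _ → subst T (sym f1) _)
  go (suc (suc i)) _ (s≤s i<m) | true =
    (λ fi → s≤s (proj₁ (ih (suc i) (s≤s z≤n) i<m) fi)) , (λ { (s≤s le) → proj₂ (ih (suc i) (s≤s z≤n) i<m) le })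
  go (suc zero) _ _ | false = (λ f1-holds → ⊥-elim (subst T f1 f1-holds)) , (λ le → ⊥-elim (g-empty f1 le))
  go (suc (suc i)) _ (s≤s i<m) | false =
    (λ fi → ⊥-elim (g-empty f1 (≤-trans (s≤s z≤n) (proj₁ (ih (suc i) (s≤s z≤n) i<m) fi)))) ,
    (λ le → ⊥-elim (g-empty f1 (≤-trans (s≤s z≤n) le)))

colLen≤n : ∀ n p j → colLen n p j ≤ n
colLen≤n n p j = count≤ _ n

module _ {n p} (isP : IsPartition n p) where

  private
    rowsReaching-downClosed : ∀ j → DownClosed (λ i → j ≤ᵇ p i) n
    rowsReaching-downClosed j i 1≤i i<n j≤p[1+i] =
      ≤⇒≤ᵇ (≤-trans (≤ᵇ⇒≤ j (p (suc i)) j≤p[1+i]) (isP i 1≤i i<n))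

  ≤p⇒≤colLen : ∀ {j i} → 1 ≤ i → i ≤ n → j ≤ p i → i ≤ colLen n p j
  ≤p⇒≤colLen {j} {i} 1≤i i≤n j≤p =
    proj₁ (count-downClosed _ n (rowsReaching-downClosed j) i 1≤i i≤n) (≤⇒≤ᵇ j≤p)

  ≤colLen⇒≤p : ∀ {j i} → 1 ≤ i → i ≤ colLen n p j → j ≤ p i
  ≤colLen⇒≤p {j} {i} 1≤i i≤c = ≤ᵇ⇒≤ j (p i)
    (proj₂ (count-downClosed _ n (rowsReaching-downClosed j) i 1≤i (≤-trans i≤c (colLen≤n n p j))) i≤c)

  colLen-antitone : ∀ j → colLen n p (suc j) ≤ colLen n p j
  colLen-antitone j with colLen n p (suc j) in eq
  ... | zero = z≤n
  ... | suc c = ≤p⇒≤colLen (s≤s z≤n) (subst (_≤ n) eq (colLen≤n n p (suc j)))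
                  (≤-trans (n≤1+n j) (≤colLen⇒≤p (s≤s z≤n) (≤-reflexive (sym eq))))

-- Fitting a value into a column

-- v fits at row i of a column ending in row c: the entries v, v + 1, … forced below it stay within β,
-- i.e. v + (k − i) ≤ β k for i ≤ k ≤ c, stated without truncated subtraction.
Fits : Tuple → ℕ → ℕ → ℕ → Set
Fits β i c v = ∀ k → i ≤ k → k ≤ c → v + k ≤ β k + i

Fits⇒≤ : ∀ {β i c v} → Fits β i c v → i ≤ c → v ≤ β i
Fits⇒≤ {i = i} fits i≤c = +-cancelʳ-≤ i _ _ (fits _ ≤-refl i≤c)

Fits-suc : ∀ {β i c v} → Fits β i c v → Fits β (suc i) c (suc v)
Fits-suc {β} {i} {v = v} fits k i<k k≤c =
  subst (suc (v + k) ≤_) (sym (+-suc (β k) i)) (s≤s (fits k (≤-trans (n≤1+n i) i<k) k≤c))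

Fits-+ : ∀ {β i c v} → Fits β i c v → ∀ t → Fits β (i + t) c (v + t)
Fits-+ {i = i} {v = v} fits zero rewrite +-identityʳ i | +-identityʳ v = fits
Fits-+ {i = i} {v = v} fits (suc t) rewrite +-suc i t | +-suc v t = Fits-suc (Fits-+ fits t)

Fits-intro : ∀ {β i c v} → (∀ t → i + t ≤ c → v + t ≤ β (i + t)) → Fits β i c v
Fits-intro {β} {i} {v = v} chain k i≤k k≤c with m≤n⇒∃[o]m+o≡n i≤k
... | t , refl =
  subst (_≤ β (i + t) + i) (trans (+-assoc v t i) (cong (v +_) (+-comm t i))) (+-monoˡ-≤ i (chain t k≤c))

Fits-mono : ∀ {β φ i c v} → (∀ k → i ≤ k → k ≤ c → β k ≤ φ k) → Fits β i c v → Fits φ i c v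
Fits-mono {i = i} β≤φ fits k i≤k k≤c = ≤-trans (fits k i≤k k≤c) (+-monoˡ-≤ i (β≤φ k i≤k k≤c))

∸≡suc∸suc : ∀ {i k} → i < k → k ∸ i ≡ suc (k ∸ suc i)
∸≡suc∸suc {zero} {suc k} _ = refl
∸≡suc∸suc {suc i} {suc k} (s≤s i<k) = ∸≡suc∸suc i<k

greatestFit : Tuple → ℕ → ℕ → ℕ
greatestFit β i zero = β i
greatestFit β i (suc d) = β i ⊓ pred (greatestFit β (suc i) d)

greatestFit≤ : ∀ β i d → greatestFit β i d ≤ β i
greatestFit≤ β i zero = ≤-refl
greatestFit≤ β i (suc d) = m⊓n≤m _ _

greatestFit-antitone : ∀ β i {d d′} → d ≤ d′ → greatestFit β i d′ ≤ greatestFit β i d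
greatestFit-antitone β i {d′ = d′} z≤n = greatestFit≤ β i d′
greatestFit-antitone β i (s≤s d≤d′) = ⊓-monoʳ-≤ (β i) (pred-mono-≤ (greatestFit-antitone β (suc i) d≤d′))

Fits⇒≤greatestFit : ∀ β i d v → Fits β i (i + d) v → v ≤ greatestFit β i d
Fits⇒≤greatestFit β i zero v fits = Fits⇒≤ fits (m≤m+n i 0)
Fits⇒≤greatestFit β i (suc d) v fits =
  ⊓-glb (Fits⇒≤ fits (m≤m+n i (suc d)))
        (pred-mono-≤ (Fits⇒≤greatestFit β (suc i) d (suc v)
          (subst (λ c → Fits β (suc i) c (suc v)) (+-suc i d) (Fits-suc fits))))

-- Row bound sets through column fits

SubS : ℕ → (ℕ → ℕ) → Tuple → Tuple → Set
SubS n p β φ = ∀ T → InS n p β T → InS n p φ T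

FitsImplies : ℕ → (ℕ → ℕ) → Tuple → Tuple → Set
FitsImplies n p β φ = ∀ j i → InShape n p j i → ∀ v → Fits β i (colLen n p j) v → Fits φ i (colLen n p j) v

InU⇒Fits-index : ∀ {n β i c} → InU n β → 1 ≤ i → c ≤ n → Fits β i c i
InU⇒Fits-index {β = β} {i} U 1≤i c≤n k i≤k k≤c =
  subst (_≤ β k + i) (+-comm k i) (+-monoˡ-≤ i (proj₁ (U k (≤-trans 1≤i i≤k) (≤-trans k≤c c≤n))))

module _ {n p} (isP : IsPartition n p) where

  InShape⇒≤colLen : ∀ {j i} → InShape n p j i → i ≤ colLen n p j
  InShape⇒≤colLen (1≤i , i≤n , _ , j≤p) = ≤p⇒≤colLen isP 1≤i i≤n j≤p

  ≤colLen⇒InShape : ∀ {j i} → 1 ≤ j → 1 ≤ i → i ≤ colLen n p j → InShape n p j i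
  ≤colLen⇒InShape {j} 1≤j 1≤i i≤c = 1≤i , ≤-trans i≤c (colLen≤n n p j) , 1≤j , ≤colLen⇒≤p isP 1≤i i≤c

  maxTableau : Tuple → Tableau
  maxTableau β j i = greatestFit β i (colLen n p j ∸ i)

  Fits⇒≤maxTableau : ∀ {β j i v} → i ≤ colLen n p j → Fits β i (colLen n p j) v → v ≤ maxTableau β j i
  Fits⇒≤maxTableau {β} {j} {i} {v} i≤c fits =
    Fits⇒≤greatestFit β i (c ∸ i) v (subst (λ c′ → Fits β i c′ v) (sym (m+[n∸m]≡n i≤c)) fits)
    where c = colLen n p j

  maxTableau-∈S : ∀ β → InU n β → InS n p β (maxTableau β)
  maxTableau-∈S β U = (entries , rows , columns) , λ j i _ → greatestFit≤ β i (colLen n p j ∸ i)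
    where
    entries : ∀ j i → InShape n p j i → 1 ≤ maxTableau β j i × maxTableau β j i ≤ n
    entries j i sh@(1≤i , i≤n , _) =
      ≤-trans 1≤i (Fits⇒≤maxTableau {j = j} (InShape⇒≤colLen {j} sh) (InU⇒Fits-index U 1≤i (colLen≤n n p j))) ,
      ≤-trans (greatestFit≤ β i (colLen n p j ∸ i)) (proj₂ (U i 1≤i i≤n))
    rows : ∀ j i → 1 ≤ j → InShape n p (suc j) i → maxTableau β j i ≤ maxTableau β (suc j) i
    rows j i _ _ = greatestFit-antitone β i (∸-monoˡ-≤ i (colLen-antitone isP j))
    columns : ∀ j i → 1 ≤ i → InShape n p j (suc i) → maxTableau β j i < maxTableau β j (suc i)
    columns j i 1≤i sh = subst (λ d → greatestFit β i d < below) (sym (∸≡suc∸suc i<c))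
      (m≤pred[n]⇒suc[m]≤n {{>-nonZero 0<below}} (m⊓n≤n (β i) (pred below)))
      where
      c = colLen n p j
      i<c = InShape⇒≤colLen {j} sh
      below = maxTableau β j (suc i)
      0<below : 0 < below
      0<below = ≤-trans (s≤s z≤n) (Fits⇒≤maxTableau {j = j} i<c (InU⇒Fits-index U (s≤s z≤n) (colLen≤n n p j)))

  SubS⇒FitsImplies : ∀ {β φ} → InU n β → SubS n p β φ → FitsImplies n p β φ
  SubS⇒FitsImplies {β} U sub j i (1≤i , _ , 1≤j , _) v fits = Fits-intro λ t i+t≤c →
    ≤-trans (Fits⇒≤maxTableau {j = j} i+t≤c (Fits-+ fits t))
            (proj₂ (sub (maxTableau β) (maxTableau-∈S β U)) j (i + t)
              (≤colLen⇒InShape 1≤j (≤-trans 1≤i (m≤m+n i t)) i+t≤c))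

  InS⇒Fits : ∀ {β T j i} → InS n p β T → InShape n p j i → Fits β i (colLen n p j) (T j i)
  InS⇒Fits {β} {T} {j} {i} ((_ , _ , columns) , bound) (1≤i , _ , 1≤j , _) = Fits-intro λ t i+t≤c →
    ≤-trans (chain t i+t≤c) (bound j (i + t) (≤colLen⇒InShape 1≤j (≤-trans 1≤i (m≤m+n i t)) i+t≤c))
    where
    chain : ∀ t → i + t ≤ colLen n p j → T j i + t ≤ T j (i + t)
    chain zero _ rewrite +-identityʳ i | +-identityʳ (T j i) = ≤-refl
    chain (suc t) i+t<c rewrite +-suc i t | +-suc (T j i) t =
      ≤-trans (s≤s (chain t (≤-trans (n≤1+n _) i+t<c)))
              (columns j (i + t) (≤-trans 1≤i (m≤m+n i t)) (≤colLen⇒InShape 1≤j (s≤s z≤n) i+t<c))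

  FitsImplies⇒SubS : ∀ {β φ} → FitsImplies n p β φ → SubS n p β φ
  FitsImplies⇒SubS imp T T∈S@(ssyt , _) =
    ssyt , λ j i sh → Fits⇒≤ (imp j i sh (T j i) (InS⇒Fits T∈S sh)) (InShape⇒≤colLen {j} sh)

-- Offsets and critical indices

-- β y − y ≤ β c − c and β y − y < β c − c, stated without truncated subtraction.
Offset≤ : Tuple → ℕ → ℕ → Set
Offset≤ β y c = β y + c ≤ β c + y

Offset< : Tuple → ℕ → ℕ → Set
Offset< β y c = β y + c < β c + y

private
  swap-right : ∀ A b B c → (A + b) + (B + c) ≡ (A + c) + (B + b)
  swap-right = solve-∀
  swap-left : ∀ B a C b → (B + a) + (C + b) ≡ (C + a) + (B + b)
  swap-left = solve-∀

module _ (β : Tuple) {y z c : ℕ} where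

  Offset<-≤-trans : Offset< β y z → Offset≤ β z c → Offset< β y c
  Offset<-≤-trans y<z z≤c = +-cancelʳ-< (β z + z) _ _
    (subst₂ _<_ (swap-right (β y) z (β z) c) (swap-left (β z) y (β c) z) (+-mono-<-≤ y<z z≤c))

  Offset≤-trans : Offset≤ β y z → Offset≤ β z c → Offset≤ β y c
  Offset≤-trans y≤z z≤c = +-cancelʳ-≤ (β z + z) _ _
    (subst₂ _≤_ (swap-right (β y) z (β z) c) (swap-left (β z) y (β c) z) (+-mono-≤ y≤z z≤c))

IsCritical : Tuple → ℕ → ℕ → ℕ → Set
IsCritical β a b y = a < y × y ≤ b × (∀ k → y < k → k ≤ b → Offset< β y k)

module _ {β : Tuple} {a y : ℕ} where

  IsCritical-extend : ∀ {x} → IsCritical β a x y → Offset< β y (suc x) → IsCritical β a (suc x) y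
  IsCritical-extend {x} (a<y , y≤x , below) y<x+1 = a<y , m≤n⇒m≤1+n y≤x , below′
    where
    below′ : ∀ k → y < k → k ≤ suc x → Offset< β y k
    below′ k y<k k≤x+1 with m≤n⇒m<n∨m≡n k≤x+1
    ... | inj₁ (s≤s k≤x) = below k y<k k≤x
    ... | inj₂ refl = y<x+1

  IsCritical-restrict : ∀ {x} → IsCritical β a (suc x) y → y ≤ x → IsCritical β a x y
  IsCritical-restrict (a<y , _ , below) y≤x = a<y , y≤x , λ k y<k k≤x → below k y<k (m≤n⇒m≤1+n k≤x)

  IsCritical⇒Offset≤ : ∀ {b k} → IsCritical β a b y → y ≤ k → k ≤ b → Offset≤ β y k
  IsCritical⇒Offset≤ (_ , _ , below) y≤k k≤b with m≤n⇒m<n∨m≡n y≤k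
  ... | inj₁ y<k = <⇒≤ (below _ y<k k≤b)
  ... | inj₂ refl = ≤-refl

scan-sound : ∀ β a c x {y} → y ∈ scan β a c x → IsCritical β a x y × Offset< β y c
scan-sound β a c (suc x) y∈ with suc x ≤ᵇ a | ≤ᵇ-reflects-≤ (suc x) a
... | false | ofⁿ x+1≰a with β (suc x) + c <ᵇ β c + suc x | <ᵇ-reflects-< (β (suc x) + c) (β c + suc x)
scan-sound β a c (suc x) (here refl) | false | ofⁿ x+1≰a | true | ofʸ x+1<c =
  (≰⇒> x+1≰a , ≤-refl , λ k x+1<k k≤x+1 → ⊥-elim (<⇒≱ x+1<k k≤x+1)) , x+1<c
scan-sound β a c (suc x) (there y∈) | false | ofⁿ _ | true | ofʸ x+1<c =
  let crit , y<x+1 = scan-sound β a (suc x) x y∈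
  in IsCritical-extend crit y<x+1 , Offset<-≤-trans β y<x+1 (<⇒≤ x+1<c)
scan-sound β a c (suc x) y∈ | false | ofⁿ _ | false | ofⁿ x+1≮c =
  let crit , y<c = scan-sound β a c x y∈
  in IsCritical-extend crit (Offset<-≤-trans β y<c (≮⇒≥ x+1≮c)) , y<c

scan-complete : ∀ β a c x {y} → IsCritical β a x y → Offset< β y c → y ∈ scan β a c x
scan-complete β a c zero (a<y , y≤0 , _) _ = ⊥-elim (<⇒≱ (≤-trans a<y y≤0) z≤n)
scan-complete β a c (suc x) crit@(a<y , y≤x+1 , below) y<c with suc x ≤ᵇ a | ≤ᵇ-reflects-≤ (suc x) a
... | true | ofʸ x+1≤a = ⊥-elim (<⇒≱ (<-≤-trans a<y y≤x+1) x+1≤a)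
... | false | ofⁿ _ with β (suc x) + c <ᵇ β c + suc x | <ᵇ-reflects-< (β (suc x) + c) (β c + suc x)
                        | m≤n⇒m<n∨m≡n y≤x+1
...   | true | _ | inj₂ refl = here refl
...   | true | _ | inj₁ (s≤s y≤x) =
  there (scan-complete β a (suc x) x (IsCritical-restrict crit y≤x) (below (suc x) (s≤s y≤x) ≤-refl))
...   | false | ofⁿ x+1≮c | inj₂ refl = ⊥-elim (x+1≮c y<c)
...   | false | _ | inj₁ (s≤s y≤x) = scan-complete β a c x (IsCritical-restrict crit y≤x) y<c

scan-decreasing : ∀ β a c x → AllPairs _>_ (scan β a c x)
scan-decreasing β a c zero = []
scan-decreasing β a c (suc x) with suc x ≤ᵇ a
... | true = []
... | false with β (suc x) + c <ᵇ β c + suc x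
... | true = All.tabulate (λ y∈ → s≤s (proj₁ (proj₂ (proj₁ (scan-sound β a (suc x) x y∈)))))
             ∷ scan-decreasing β a (suc x) x
... | false = scan-decreasing β a c x

critsC-sound : ∀ β a b {y} → a < b → y ∈ critsC β a b → IsCritical β a b y
critsC-sound β a (suc b) a<b (here refl) = a<b , ≤-refl , λ k b<k k≤b → ⊥-elim (<⇒≱ b<k k≤b)
critsC-sound β a (suc b) a<b (there y∈) =
  let crit , y<b = scan-sound β a (suc b) b y∈ in IsCritical-extend crit y<b

critsC-complete : ∀ β a b {y} → IsCritical β a b y → y ∈ critsC β a b
critsC-complete β a b crit@(_ , y≤b , below) with m≤n⇒m<n∨m≡n y≤b
... | inj₂ refl = here refl
critsC-complete β a (suc b) crit@(_ , _ , below) | inj₁ (s≤s y≤b) =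
  there (scan-complete β a (suc b) b (IsCritical-restrict crit y≤b) (below (suc b) (s≤s y≤b) ≤-refl))

critsC-decreasing : ∀ β a b → AllPairs _>_ (critsC β a b)
critsC-decreasing β a zero = [] ∷ scan-decreasing β a zero zero
critsC-decreasing β a (suc b) =
  All.tabulate (λ y∈ → s≤s (proj₁ (proj₂ (proj₁ (scan-sound β a (suc b) b y∈))))) ∷ scan-decreasing β a (suc b) b

SuffixMin : Tuple → ℕ → ℕ → ℕ → Set
SuffixMin β m b z = ∀ k → m ≤ k → k ≤ b → Offset≤ β z k

critical-suffixMin : ∀ β a b m → a < m → m ≤ b → ∃ λ z → m ≤ z × IsCritical β a b z × SuffixMin β m b z
critical-suffixMin β a b m a<m m≤b with m≤n⇒∃[o]m+o≡n m≤b
... | d , m+d≡b = go d m a<m m+d≡b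
  where
  go : ∀ d m → a < m → m + d ≡ b → ∃ λ z → m ≤ z × IsCritical β a b z × SuffixMin β m b z
  go zero m a<m m+0≡b rewrite +-identityʳ m | m+0≡b =
    b , ≤-refl , (a<m , ≤-refl , λ k b<k k≤b → ⊥-elim (<⇒≱ b<k k≤b)) ,
    λ k b≤k k≤b → subst (λ l → Offset≤ β b l) (≤-antisym b≤k k≤b) ≤-refl
  go (suc d) m a<m m+d+1≡b with go d (suc m) (m<n⇒m<1+n a<m) (trans (sym (+-suc m d)) m+d+1≡b)
  ... | z , m<z , crit@(_ , z≤b , _) , zmin with β m + z <? β z + m
  ...   | yes m<z-offset = m , ≤-refl , m-crit , λ k m≤k k≤b → IsCritical⇒Offset≤ m-crit m≤k k≤b
    where
    m-crit : IsCritical β a b m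
    m-crit = a<m , subst (m ≤_) m+d+1≡b (m≤m+n m (suc d)) ,
             λ k m<k k≤b → Offset<-≤-trans β m<z-offset (zmin k m<k k≤b)
  ...   | no m≮z-offset = z , ≤-trans (n≤1+n m) m<z , crit , zmin′
    where
    zmin′ : SuffixMin β m b z
    zmin′ k m≤k k≤b with m≤n⇒m<n∨m≡n m≤k
    ... | inj₁ m<k = zmin k m<k k≤b
    ... | inj₂ refl = ≮⇒≥ m≮z-offset

-- Carrels

module CarrelStructure (n : ℕ) (p : ℕ → ℕ) where

  R : List ℕ
  R = Rlist n p

  IsColumnLength : ℕ → Set
  IsColumnLength q = ∃ λ j → 1 ≤ j × j ≤ p 1 × colLen n p j ≡ q

  ∈R⁻ : ∀ {q} → q ∈ R → 1 ≤ q × q < n × IsColumnLength q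
  ∈R⁻ {q} q∈R with ∈-filterB⁻ (oneTo n) q∈R
  ... | _ , isR[q] with Equivalence.to T-∧ isR[q]
  ... | 1≤ᵇq , rest with Equivalence.to T-∧ rest
  ... | q<ᵇn , column with find (Any.any⁻ _ (oneTo (p 1)) column)
  ... | j , j∈ , colLen≡ᵇq =
    ≤ᵇ⇒≤ 1 q 1≤ᵇq , <ᵇ⇒< q n q<ᵇn , j , proj₁ (∈-oneTo⁻ j∈) , proj₂ (∈-oneTo⁻ j∈) , ≡ᵇ⇒≡ _ q colLen≡ᵇq

  ∈R⁺ : ∀ {q} → 1 ≤ q → q < n → IsColumnLength q → q ∈ R
  ∈R⁺ {q} 1≤q q<n (j , 1≤j , j≤p1 , colLen≡q) = ∈-filterB⁺ (∈-oneTo⁺ 1≤q (<⇒≤ q<n))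
    (Equivalence.from T-∧ (≤⇒≤ᵇ 1≤q , Equivalence.from T-∧ (<⇒<ᵇ q<n ,
      Any.any⁺ _ (lose (∈-oneTo⁺ 1≤j j≤p1) (≡⇒≡ᵇ _ q colLen≡q)))))

  1≤∈R : ∀ {q} → q ∈ R → 1 ≤ q
  1≤∈R q∈R = proj₁ (∈R⁻ q∈R)

  <n∈R : ∀ {q} → q ∈ R → q < n
  <n∈R q∈R = proj₁ (proj₂ (∈R⁻ q∈R))

  R-increasing : AllPairs _<_ R
  R-increasing = AllPairs-filterB (isR n p) (subst (AllPairs _<_) (sym (map-applyUpTo (λ i → i) suc n))
    (AllPairs.applyUpTo⁺₁ suc n (λ i<j _ → s≤s i<j)))

  IsCarrelEnd : ℕ → Set
  IsCarrelEnd c = c ≡ n ⊎ c ∈ R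

  IsCarrelEnd⇒≤n : ∀ {c} → IsCarrelEnd c → c ≤ n
  IsCarrelEnd⇒≤n (inj₁ refl) = ≤-refl
  IsCarrelEnd⇒≤n (inj₂ c∈R) = <⇒≤ (<n∈R c∈R)

  hi≤n : ∀ k → hi n p k ≤ n
  hi≤n k = foldr-⊓-≤-init n (filterB (k ≤ᵇ_) R)

  hi-sel : ∀ k → hi n p k ≡ n ⊎ (hi n p k ∈ R × k ≤ hi n p k)
  hi-sel k with foldr-⊓-sel n (filterB (k ≤ᵇ_) R)
  ... | inj₁ eq = inj₁ eq
  ... | inj₂ hi∈ with ∈-filterB⁻ R hi∈
  ...   | hi∈R , k≤ᵇhi = inj₂ (hi∈R , ≤ᵇ⇒≤ k _ k≤ᵇhi)

  IsCarrelEnd-hi : ∀ k → IsCarrelEnd (hi n p k)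
  IsCarrelEnd-hi k with hi-sel k
  ... | inj₁ eq = inj₁ eq
  ... | inj₂ (hi∈R , _) = inj₂ hi∈R

  hi-least : ∀ k {c} → IsCarrelEnd c → k ≤ c → hi n p k ≤ c
  hi-least k (inj₁ refl) _ = hi≤n k
  hi-least k (inj₂ c∈R) k≤c = foldr-⊓-≤-∈ n _ (∈-filterB⁺ c∈R (≤⇒≤ᵇ k≤c))

  ≤hi : ∀ k → k ≤ n → k ≤ hi n p k
  ≤hi k k≤n with hi-sel k
  ... | inj₁ eq = subst (k ≤_) (sym eq) k≤n
  ... | inj₂ (_ , k≤hi) = k≤hi

  hi-∈R : ∀ {q} → q ∈ R → hi n p q ≡ q
  hi-∈R q∈R = ≤-antisym (hi-least _ (inj₂ q∈R) ≤-refl) (≤hi _ (<⇒≤ (<n∈R q∈R)))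

  lo-sel : ∀ k → lo n p k ≡ 0 ⊎ (lo n p k ∈ R × lo n p k < k)
  lo-sel k with foldr-⊔-sel (filterB (_<ᵇ k) R)
  ... | inj₁ eq = inj₁ eq
  ... | inj₂ lo∈ with ∈-filterB⁻ R lo∈
  ...   | lo∈R , lo<ᵇk = inj₂ (lo∈R , <ᵇ⇒< _ k lo<ᵇk)

  lo-greatest : ∀ k {q} → q ∈ R → q < k → q ≤ lo n p k
  lo-greatest k q∈R q<k = ∈⇒≤-foldr-⊔ _ (∈-filterB⁺ q∈R (<⇒<ᵇ q<k))

  lo< : ∀ k → 1 ≤ k → lo n p k < k
  lo< k 1≤k with lo-sel k
  ... | inj₁ eq = subst (_< k) (sym eq) 1≤k
  ... | inj₂ (_ , lo<k) = lo<k

  lo-suc-∈R : ∀ {q} → q ∈ R → lo n p (suc q) ≡ q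
  lo-suc-∈R {q} q∈R = ≤-antisym lo≤q (lo-greatest (suc q) q∈R ≤-refl)
    where
    lo≤q : lo n p (suc q) ≤ q
    lo≤q with lo-sel (suc q)
    ... | inj₁ eq = subst (_≤ q) (sym eq) z≤n
    ... | inj₂ (_ , s≤s lo≤q) = lo≤q

  hi-carrel : ∀ k m → k ≤ m → m ≤ hi n p k → hi n p m ≡ hi n p k
  hi-carrel k m k≤m m≤hi = ≤-antisym (hi-least m (IsCarrelEnd-hi k) m≤hi)
    (hi-least k (IsCarrelEnd-hi m) (≤-trans k≤m (≤hi m (≤-trans m≤hi (hi≤n k)))))

  lo-carrel : ∀ k m → k ≤ m → m ≤ hi n p k → lo n p m ≡ lo n p k
  lo-carrel k m k≤m m≤hi = ≤-antisym lo[m]≤lo[k] lo[k]≤lo[m]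
    where
    lo[m]≤lo[k] : lo n p m ≤ lo n p k
    lo[m]≤lo[k] with lo-sel m
    ... | inj₁ eq = subst (_≤ lo n p k) (sym eq) z≤n
    ... | inj₂ (lo∈R , lo<m) with lo n p m <? k
    ...   | yes lo<k = lo-greatest k lo∈R lo<k
    ...   | no lo≮k = ⊥-elim (<⇒≱ lo<m (≤-trans m≤hi (hi-least k (inj₂ lo∈R) (≮⇒≥ lo≮k))))
    lo[k]≤lo[m] : lo n p k ≤ lo n p m
    lo[k]≤lo[m] with lo-sel k
    ... | inj₁ eq = subst (_≤ lo n p m) (sym eq) z≤n
    ... | inj₂ (lo∈R , lo<k) = lo-greatest m lo∈R (<-≤-trans lo<k k≤m)

  pairs : ℕ → List ℕ → List (ℕ × ℕ)
  pairs x Q = zip (x ∷ Q) (Q ++ n ∷ [])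

  record Consecutive (x : ℕ) (Q : List ℕ) (a b : ℕ) : Set where
    field
      a<b : a < b
      a∈ : a ∈ x ∷ Q
      b-end : b ≡ n ⊎ b ∈ Q
      gap : ∀ q → q ∈ x ∷ Q → q ≤ a ⊎ b ≤ q

  pairs-consecutive : ∀ x Q → AllPairs _<_ (x ∷ Q) → All (_< n) (x ∷ Q) →
                      ∀ {a b} → (a , b) ∈ pairs x Q → Consecutive x Q a b
  pairs-consecutive x [] _ (x<n ∷ []) (here refl) = record
    { a<b = x<n ; a∈ = here refl ; b-end = inj₁ refl ; gap = λ { q (here refl) → inj₁ ≤-refl } }
  pairs-consecutive x (q₀ ∷ Q) ((x<q₀ ∷ _) ∷ q₀<Q ∷ _) _ (here refl) = record
    { a<b = x<q₀ ; a∈ = here refl ; b-end = inj₂ (here refl) ; gap = gap }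
    where
    gap : ∀ q → q ∈ x ∷ q₀ ∷ Q → q ≤ x ⊎ q₀ ≤ q
    gap q (here refl) = inj₁ ≤-refl
    gap q (there (here refl)) = inj₂ ≤-refl
    gap q (there (there q∈Q)) = inj₂ (<⇒≤ (All.lookup q₀<Q q∈Q))
  pairs-consecutive x (q₀ ∷ Q) ((x<q₀ ∷ _) ∷ sorted@(q₀<Q ∷ _)) (_ ∷ bounded) {a} {b} (there ab∈) = record
    { a<b = a<b ; a∈ = there a∈ ; b-end = map₂ there b-end ; gap = gap′ }
    where
    open Consecutive (pairs-consecutive q₀ Q sorted bounded ab∈)
    q₀≤a : q₀ ≤ a
    q₀≤a with a∈
    ... | here refl = ≤-refl
    ... | there a∈Q = <⇒≤ (All.lookup q₀<Q a∈Q)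
    gap′ : ∀ q → q ∈ x ∷ q₀ ∷ Q → q ≤ a ⊎ b ≤ q
    gap′ q (here refl) = inj₁ (≤-trans (<⇒≤ x<q₀) q₀≤a)
    gap′ q (there q∈) = gap q q∈

  pairs-cover : ∀ x Q u → x < u → u ≤ n → ∃ λ ab → ab ∈ pairs x Q × proj₁ ab < u × u ≤ proj₂ ab
  pairs-cover x [] u x<u u≤n = (x , n) , here refl , x<u , u≤n
  pairs-cover x (q₀ ∷ Q) u x<u u≤n with u ≤? q₀
  ... | yes u≤q₀ = (x , q₀) , here refl , x<u , u≤q₀
  ... | no u≰q₀ with pairs-cover q₀ Q u (≰⇒> u≰q₀) u≤n
  ...   | ab , ab∈ , a<u , u≤b = ab , there ab∈ , a<u , u≤b

  module _ (1≤n : 1 ≤ n) where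

    carrel-consecutive : ∀ {a b} → (a , b) ∈ carrels n p → Consecutive 0 R a b
    carrel-consecutive = pairs-consecutive 0 R (All.tabulate 1≤∈R ∷ R-increasing) (1≤n ∷ All.tabulate <n∈R)

    carrel-≤n : ∀ {a b} → (a , b) ∈ carrels n p → b ≤ n
    carrel-≤n ab∈ = IsCarrelEnd⇒≤n (Consecutive.b-end (carrel-consecutive ab∈))

    carrel-lo-hi : ∀ {a b} → (a , b) ∈ carrels n p → ∀ u → a < u → u ≤ b → lo n p u ≡ a × hi n p u ≡ b
    carrel-lo-hi {a} {b} ab∈ u a<u u≤b = ≤-antisym lo≤a a≤lo , ≤-antisym (hi-least u b-end u≤b) b≤hi
      where
      open Consecutive (carrel-consecutive ab∈)
      a≤lo : a ≤ lo n p u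
      a≤lo with a∈
      ... | here refl = z≤n
      ... | there a∈R = lo-greatest u a∈R a<u
      lo≤a : lo n p u ≤ a
      lo≤a with lo-sel u
      ... | inj₁ eq = subst (_≤ a) (sym eq) z≤n
      ... | inj₂ (lo∈R , lo<u) with gap _ (there lo∈R)
      ...   | inj₁ lo≤a = lo≤a
      ...   | inj₂ b≤lo = ⊥-elim (<⇒≱ lo<u (≤-trans u≤b b≤lo))
      b≤hi : b ≤ hi n p u
      b≤hi with hi-sel u
      ... | inj₁ eq = subst (b ≤_) (sym eq) (IsCarrelEnd⇒≤n b-end)
      ... | inj₂ (hi∈R , u≤hi) with gap _ (there hi∈R)
      ...   | inj₁ hi≤a = ⊥-elim (<⇒≱ a<u (≤-trans u≤hi hi≤a))
      ...   | inj₂ b≤hi = b≤hi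

    carrel-of : ∀ u → 1 ≤ u → u ≤ n → (lo n p u , hi n p u) ∈ carrels n p
    carrel-of u 1≤u u≤n with pairs-cover 0 R u 1≤u u≤n
    ... | (a , b) , ab∈ , a<u , u≤b with carrel-lo-hi ab∈ u a<u u≤b
    ...   | refl , refl = ab∈

    module _ (β : Tuple) where

      carrelCrits : ℕ × ℕ → List ℕ
      carrelCrits ab = reverse (critsC β (proj₁ ab) (proj₂ ab))

      critList⁻ : ∀ {u} → u ∈ critList n p β → 1 ≤ u × u ≤ n × u ∈ critsOf n p β u
      critList⁻ {u} u∈ with find (Any.map⁻ (∈-concat⁻ (map carrelCrits (carrels n p)) u∈))
      ... | (a , b) , ab∈ , u∈′
        with critsC-sound β a b (Consecutive.a<b (carrel-consecutive ab∈)) (Any.reverse⁻ u∈′)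
      ...   | a<u , u≤b , _ with carrel-lo-hi ab∈ u a<u u≤b
      ...     | refl , refl = ≤-trans (s≤s z≤n) a<u , ≤-trans u≤b (carrel-≤n ab∈) , Any.reverse⁻ u∈′

      critList⁺ : ∀ {u} → 1 ≤ u → u ≤ n → u ∈ critsOf n p β u → u ∈ critList n p β
      critList⁺ 1≤u u≤n u∈ = ∈-concat⁺ (Any.map⁺ (lose (carrel-of _ 1≤u u≤n) (Any.reverse⁺ u∈)))

      private
        carrelCrits-increasing : ∀ a b → a < b →
          AllPairs _<_ (carrelCrits (a , b)) × All (λ u → a < u × u ≤ b) (carrelCrits (a , b))
        carrelCrits-increasing a b a<b = AllPairs-reverse (critsC β a b) (critsC-decreasing β a b) ,
          All.tabulate (λ u∈ → let a<u , u≤b , _ = critsC-sound β a b a<b (Any.reverse⁻ u∈) in a<u , u≤b)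

        pairsCrits-increasing : ∀ x Q → AllPairs _<_ (x ∷ Q) → All (_< n) (x ∷ Q) →
          AllPairs _<_ (concat (map carrelCrits (pairs x Q))) × All (x <_) (concat (map carrelCrits (pairs x Q)))
        pairsCrits-increasing x [] _ (x<n ∷ []) with carrelCrits-increasing x n x<n
        ... | sorted , bounded =
          AllPairs.++⁺ sorted [] (All.tabulate (λ _ → [])) , All.++⁺ (All.map proj₁ bounded) []
        pairsCrits-increasing x (q₀ ∷ Q) (x<Q ∷ sorted) (x<n ∷ bounded)
          with carrelCrits-increasing x q₀ (All.head x<Q) | pairsCrits-increasing q₀ Q sorted bounded
        ... | block , inBlock | rest , q₀<rest =
          AllPairs.++⁺ block rest (All.map (λ (_ , u≤q₀) → All.map (≤-<-trans u≤q₀) q₀<rest) inBlock) ,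
          All.++⁺ (All.map proj₁ inBlock) (All.map (<-trans (All.head x<Q)) q₀<rest)

      critList-increasing : AllPairs _<_ (critList n p β)
      critList-increasing =
        proj₁ (pairsCrits-increasing 0 R (All.tabulate 1≤∈R ∷ R-increasing) (1≤n ∷ All.tabulate <n∈R))

-- The λ-core and the λ-floor map

∸-+-cancel : ∀ {y x A} → y ≤ x → x ≤ A → A ∸ (x ∸ y) + x ≡ A + y
∸-+-cancel {y} {x} {A} y≤x x≤A = begin
  A ∸ (x ∸ y) + x              ≡⟨ cong (A ∸ (x ∸ y) +_) (sym (m∸n+n≡m y≤x)) ⟩
  A ∸ (x ∸ y) + (x ∸ y + y)    ≡⟨ sym (+-assoc (A ∸ (x ∸ y)) (x ∸ y) y) ⟩
  A ∸ (x ∸ y) + (x ∸ y) + y    ≡⟨ cong (_+ y) (m∸n+n≡m (≤-trans (m∸n≤m x y) x≤A)) ⟩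
  A + y                        ∎
  where open ≡-Reasoning

+-≤-transport : ∀ {v x A i C k} → v + x ≤ A + i → C + x ≡ A + k → v + k ≤ C + i
+-≤-transport {v} {x} {A} {i} {C} {k} v+x≤A+i C+x≡A+k = +-cancelʳ-≤ x (v + k) (C + i) (begin
  v + k + x    ≡⟨ xy∙z≈xz∙y v k x ⟩
  v + x + k    ≤⟨ +-monoˡ-≤ k v+x≤A+i ⟩
  A + i + k    ≡⟨ xy∙z≈xz∙y A i k ⟩
  A + k + i    ≡⟨ cong (_+ i) (sym C+x≡A+k) ⟩
  C + x + i    ≡⟨ xy∙z≈xz∙y C x i ⟩
  C + i + x    ∎)
  where open ≤-Reasoning

CriticallyMonotone : ℕ → (ℕ → ℕ) → Tuple → Set
CriticallyMonotone n p γ =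
  ∀ {u v} → 1 ≤ u → v ≤ n → u ∈ critsOf n p γ u → v ∈ critsOf n p γ v → u < v → γ u ≤ γ v

module CoreFloor (n : ℕ) (p : ℕ → ℕ) (1≤n : 1 ≤ n) where
  open CarrelStructure n p

  lo<hi : ∀ k → 1 ≤ k → k ≤ n → lo n p k < hi n p k
  lo<hi k 1≤k k≤n = <-≤-trans (lo< k 1≤k) (≤hi k k≤n)

  module _ (δ : Tuple) where

    critsOf-IsCritical : ∀ {k y} → 1 ≤ k → k ≤ n → y ∈ critsOf n p δ k → IsCritical δ (lo n p k) (hi n p k) y
    critsOf-IsCritical {k} 1≤k k≤n = critsC-sound δ (lo n p k) (hi n p k) (lo<hi k 1≤k k≤n)

    critsOf-carrel : ∀ k m → k ≤ m → m ≤ hi n p k → critsOf n p δ m ≡ critsOf n p δ k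
    critsOf-carrel k m k≤m m≤hi = cong₂ (critsC δ) (lo-carrel k m k≤m m≤hi) (hi-carrel k m k≤m m≤hi)

    record IsNextCritical (k x : ℕ) : Set where
      field
        critical : x ∈ critsOf n p δ k
        k≤x : k ≤ x
        x≤hi : x ≤ hi n p k
        least : ∀ {y} → y ∈ critsOf n p δ k → k ≤ y → x ≤ y

    nextCrit-spec : ∀ k → k ≤ n → IsNextCritical k (nextCrit n p δ k)
    nextCrit-spec k k≤n = record
      { critical = critical
      ; k≤x = k≤x
      ; x≤hi = foldr-⊓-≤-init (hi n p k) later
      ; least = λ y∈ k≤y → foldr-⊓-≤-∈ (hi n p k) later (∈-filterB⁺ y∈ (≤⇒≤ᵇ k≤y))
      }
      where
      later = filterB (k ≤ᵇ_) (critsOf n p δ k)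
      critical : nextCrit n p δ k ∈ critsOf n p δ k
      critical with foldr-⊓-sel (hi n p k) later
      ... | inj₁ eq = subst (_∈ critsOf n p δ k) (sym eq) (here refl)
      ... | inj₂ x∈ = proj₁ (∈-filterB⁻ (critsOf n p δ k) x∈)
      k≤x : k ≤ nextCrit n p δ k
      k≤x with foldr-⊓-sel (hi n p k) later
      ... | inj₁ eq = subst (k ≤_) (sym eq) (≤hi k k≤n)
      ... | inj₂ x∈ = ≤ᵇ⇒≤ k _ (proj₂ (∈-filterB⁻ (critsOf n p δ k) x∈))

    nextCrit-critical : ∀ k → k ≤ n → nextCrit n p δ k ∈ critsOf n p δ (nextCrit n p δ k)
    nextCrit-critical k k≤n =
      subst (nextCrit n p δ k ∈_) (sym (critsOf-carrel k _ k≤x x≤hi)) critical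
      where open IsNextCritical (nextCrit-spec k k≤n)

    nextCrit-self : ∀ y → y ≤ n → y ∈ critsOf n p δ y → nextCrit n p δ y ≡ y
    nextCrit-self y y≤n y∈ = ≤-antisym (least y∈ ≤-refl) k≤x
      where open IsNextCritical (nextCrit-spec y y≤n)

    nextCrit-suffixMin : ∀ k → 1 ≤ k → k ≤ n → SuffixMin δ k (hi n p k) (nextCrit n p δ k)
    nextCrit-suffixMin k 1≤k k≤n m k≤m m≤hi
      with critical-suffixMin δ (lo n p k) (hi n p k) k (lo< k 1≤k) (≤hi k k≤n)
    ... | z , k≤z , z-crit@(_ , z≤hi , _) , z-min =
      Offset≤-trans δ (IsCritical⇒Offset≤ (critsOf-IsCritical 1≤k k≤n critical) x≤z z≤hi) (z-min m k≤m m≤hi)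
      where
      open IsNextCritical (nextCrit-spec k k≤n)
      x≤z = least (critsC-complete δ (lo n p k) (hi n p k) z-crit) k≤z

    minCrit-∈ : ∀ k → minCrit n p δ k ∈ critsOf n p δ k
    minCrit-∈ k with foldr-⊓-sel (hi n p k) (critsOf n p δ k)
    ... | inj₁ eq = subst (_∈ critsOf n p δ k) (sym eq) (here refl)
    ... | inj₂ m∈ = m∈

    minCrit-least : ∀ k {y} → y ∈ critsOf n p δ k → minCrit n p δ k ≤ y
    minCrit-least k = foldr-⊓-≤-∈ (hi n p k) (critsOf n p δ k)

    isCrit⇒∈ : ∀ k → T (isCrit n p δ k) → k ∈ critsOf n p δ k
    isCrit⇒∈ k isCrit[k] with find (Any.any⁻ _ (critsOf n p δ k) isCrit[k])
    ... | y , y∈ , y≡ᵇk = subst (_∈ critsOf n p δ k) (≡ᵇ⇒≡ y k y≡ᵇk) y∈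

    ∈⇒isCrit : ∀ k → k ∈ critsOf n p δ k → isCrit n p δ k ≡ true
    ∈⇒isCrit k k∈ = Equivalence.to T-≡ (Any.any⁺ _ (lose k∈ (≡⇒≡ᵇ k k refl)))

    core-critical : ∀ y → y ≤ n → y ∈ critsOf n p δ y → core n p δ y ≡ δ y
    core-critical y y≤n y∈ rewrite nextCrit-self y y≤n y∈ | n∸n≡0 y = refl

    module _ (U : InU n δ) where

      nextCrit-≤n : ∀ k → k ≤ n → nextCrit n p δ k ≤ n
      nextCrit-≤n k k≤n = ≤-trans (IsNextCritical.x≤hi (nextCrit-spec k k≤n)) (hi≤n k)

      core-offset : ∀ k → 1 ≤ k → k ≤ n → core n p δ k + nextCrit n p δ k ≡ δ (nextCrit n p δ k) + k
      core-offset k 1≤k k≤n = ∸-+-cancel k≤x (proj₁ (U _ (≤-trans 1≤k k≤x) (nextCrit-≤n k k≤n)))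
        where open IsNextCritical (nextCrit-spec k k≤n)

      core≤ : ∀ k → 1 ≤ k → k ≤ n → core n p δ k ≤ δ k
      core≤ k 1≤k k≤n = +-cancelʳ-≤ x _ _ (begin
        core n p δ k + x   ≡⟨ core-offset k 1≤k k≤n ⟩
        δ x + k            ≤⟨ nextCrit-suffixMin k 1≤k k≤n k ≤-refl (≤hi k k≤n) ⟩
        δ k + x            ∎)
        where
        open ≤-Reasoning
        x = nextCrit n p δ k

      core-upper : InU n (core n p δ)
      core-upper k 1≤k k≤n =
        +-cancelʳ-≤ x _ _ (subst (k + x ≤_) (sym (core-offset k 1≤k k≤n))
                            (≤-trans (≤-reflexive (+-comm k x)) (+-monoˡ-≤ k (proj₁ (U x 1≤x x≤n))))) ,
        ≤-trans (m∸n≤m (δ x) (x ∸ k)) (proj₂ (U x 1≤x x≤n))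
        where
        x = nextCrit n p δ k
        x≤n = nextCrit-≤n k k≤n
        1≤x = ≤-trans 1≤k (IsNextCritical.k≤x (nextCrit-spec k k≤n))

      ≤-at-nextCrit⇒≤core : ∀ k → 1 ≤ k → k ≤ n → ∀ {v i} →
        v + nextCrit n p δ k ≤ δ (nextCrit n p δ k) + i → v + k ≤ core n p δ k + i
      ≤-at-nextCrit⇒≤core k 1≤k k≤n {v} {i} bound =
        +-≤-transport {v} {x} {δ x} {i} {core n p δ k} {k} bound (core-offset k 1≤k k≤n)
        where x = nextCrit n p δ k

      Fits-core⁺ : ∀ {c} → IsCarrelEnd c → ∀ {i v} → 1 ≤ i → Fits δ i c v → Fits (core n p δ) i c v
      Fits-core⁺ c-end 1≤i fits k i≤k k≤c =
        ≤-at-nextCrit⇒≤core k (≤-trans 1≤i i≤k) k≤n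
          (fits _ (≤-trans i≤k k≤x) (≤-trans x≤hi (hi-least k c-end k≤c)))
        where
        k≤n = ≤-trans k≤c (IsCarrelEnd⇒≤n c-end)
        open IsNextCritical (nextCrit-spec k k≤n)

      Fits-core⁻ : ∀ {c} → c ≤ n → ∀ {i v} → 1 ≤ i → Fits (core n p δ) i c v → Fits δ i c v
      Fits-core⁻ c≤n 1≤i = Fits-mono λ k i≤k k≤c → core≤ k (≤-trans 1≤i i≤k) (≤-trans k≤c c≤n)

  Special : Tuple → ℕ → Bool
  Special γ k = (0 <ᵇ lo n p k) ∧ (nextCrit n p γ k ≡ᵇ minCrit n p γ k)

  module _ (γ : Tuple) where

    floor-cases : ∀ k → k ≤ n →
      floor n p γ k ≡ core n p γ k ⊎
      (isCrit n p γ k ≡ false × T (Special γ k) × floor n p γ k ≡ γ (lo n p k) ⊔ core n p γ k)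
    floor-cases k k≤n with isCrit n p γ k in crit | Special γ k in special
    ... | true | _ = inj₁ (sym (core-critical γ k k≤n (isCrit⇒∈ γ k (Equivalence.from T-≡ crit))))
    ... | false | true = inj₂ (refl , _ , refl)
    ... | false | false = inj₁ refl

    core≤floor : ∀ k → k ≤ n → core n p γ k ≤ floor n p γ k
    core≤floor k k≤n with floor-cases k k≤n
    ... | inj₁ eq = ≤-reflexive (sym eq)
    ... | inj₂ (_ , _ , eq) = subst (core n p γ k ≤_) (sym eq) (m≤n⊔m _ _)

    floor-critical : ∀ y → y ∈ critsOf n p γ y → floor n p γ y ≡ γ y
    floor-critical y y∈ rewrite ∈⇒isCrit γ y y∈ = refl

    floor-special : ∀ k → isCrit n p γ k ≡ false → T (Special γ k) → floor n p γ k ≡ γ (lo n p k) ⊔ core n p γ k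
    floor-special k not-crit special rewrite not-crit with Special γ k
    ... | true = refl

    Fits-floor⁺ : ∀ {c} → c ≤ n → ∀ {i v} → Fits (core n p γ) i c v → Fits (floor n p γ) i c v
    Fits-floor⁺ c≤n = Fits-mono λ k _ k≤c → core≤floor k (≤-trans k≤c c≤n)

    Fits-floor⁻ : InU n γ → ∀ {c} → IsCarrelEnd c →
                  ∀ {i v} → 1 ≤ i → Fits (floor n p γ) i c v → Fits (core n p γ) i c v
    Fits-floor⁻ U c-end {i} {v} 1≤i fits k i≤k k≤c with floor-cases k k≤n
      where k≤n = ≤-trans k≤c (IsCarrelEnd⇒≤n c-end)
    ... | inj₁ eq = subst (λ f → v + k ≤ f + i) eq (fits k i≤k k≤c)
    ... | inj₂ _ = ≤-at-nextCrit⇒≤core γ U k (≤-trans 1≤i i≤k) k≤n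
        (subst (λ f → v + x ≤ f + i) (floor-critical x (nextCrit-critical γ k k≤n))
               (fits x (≤-trans i≤k k≤x) (≤-trans x≤hi (hi-least k c-end k≤c))))
      where
      k≤n = ≤-trans k≤c (IsCarrelEnd⇒≤n c-end)
      x = nextCrit n p γ k
      open IsNextCritical (nextCrit-spec γ k k≤n)

  ∈R⇒critical : ∀ δ {q} → q ∈ R → q ∈ critsOf n p δ q
  ∈R⇒critical δ {q} q∈R = subst (λ b → q ∈ critsC δ (lo n p q) b) (sym (hi-∈R q∈R)) (here refl)

  Special⇒lo∈R : ∀ γ k → T (Special γ k) → lo n p k ∈ R
  Special⇒lo∈R γ k special with lo-sel k
  ... | inj₁ eq = ⊥-elim (<-irrefl (sym eq) (<ᵇ⇒< 0 _ (proj₁ (Equivalence.to T-∧ special))))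
  ... | inj₂ (lo∈R , _) = lo∈R

  nextCrit≡minCrit : ∀ δ m → m ≤ n → (∀ {y} → y ∈ critsOf n p δ m → m ≤ y) → nextCrit n p δ m ≡ minCrit n p δ m
  nextCrit≡minCrit δ m m≤n m≤crits =
    ≤-antisym (least (minCrit-∈ δ m) (m≤crits (minCrit-∈ δ m))) (minCrit-least δ m critical)
    where open IsNextCritical (nextCrit-spec δ m m≤n)

  module _ (δ : Tuple) (U : InU n δ) where

    core-strict-in-carrel : ∀ k → 1 ≤ k → suc k ≤ hi n p k → core n p δ k < core n p δ (suc k)
    core-strict-in-carrel k 1≤k k<hi = +-cancelʳ-< (x + x′) _ _ (begin-strict
      core n p δ k + (x + x′)      ≡⟨ sym (+-assoc (core n p δ k) x x′) ⟩
      core n p δ k + x + x′        ≡⟨ cong (_+ x′) (core-offset δ U k 1≤k k≤n) ⟩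
      δ x + k + x′                 ≡⟨ xy∙z≈xz∙y (δ x) k x′ ⟩
      δ x + x′ + k                 <⟨ +-monoʳ-< (δ x + x′) (n<1+n k) ⟩
      δ x + x′ + suc k             ≤⟨ +-monoˡ-≤ (suc k) x-below-x′ ⟩
      δ x′ + x + suc k             ≡⟨ xy∙z≈xz∙y (δ x′) x (suc k) ⟩
      δ x′ + suc k + x             ≡⟨ cong (_+ x) (sym (core-offset δ U (suc k) (s≤s z≤n) k<n)) ⟩
      core n p δ (suc k) + x′ + x  ≡⟨ +-assoc (core n p δ (suc k)) x′ x ⟩
      core n p δ (suc k) + (x′ + x) ≡⟨ cong (core n p δ (suc k) +_) (+-comm x′ x) ⟩
      core n p δ (suc k) + (x + x′) ∎)
      where
      open ≤-Reasoning
      k<n = ≤-trans k<hi (hi≤n k)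
      k≤n = <⇒≤ k<n
      x = nextCrit n p δ k
      x′ = nextCrit n p δ (suc k)
      open IsNextCritical (nextCrit-spec δ (suc k) k<n) renaming (k≤x to k+1≤x′; x≤hi to x′≤hi′)
      x′≤hi : x′ ≤ hi n p k
      x′≤hi = subst (x′ ≤_) (hi-carrel k (suc k) (n≤1+n k) k<hi) x′≤hi′
      x-below-x′ : Offset≤ δ x x′
      x-below-x′ = nextCrit-suffixMin δ k 1≤k k≤n x′ (≤-trans (n≤1+n k) k+1≤x′) x′≤hi

    core-critical⇒critical : ∀ y → 1 ≤ y → y ≤ n → y ∈ critsOf n p (core n p δ) y → y ∈ critsOf n p δ y
    core-critical⇒critical y 1≤y y≤n y∈ = by-cases (m≤n⇒m<n∨m≡n k≤x)
      where
      open IsNextCritical (nextCrit-spec δ y y≤n)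
      x = nextCrit n p δ y
      offsets-equal : core n p δ y + x ≡ core n p δ x + y
      offsets-equal = trans (core-offset δ U y 1≤y y≤n)
        (cong (_+ y) (sym (core-critical δ x (nextCrit-≤n δ U y y≤n) (nextCrit-critical δ y y≤n))))
      by-cases : y < x ⊎ y ≡ x → y ∈ critsOf n p δ y
      by-cases (inj₂ y≡x) = subst (_∈ critsOf n p δ y) (sym y≡x) critical
      by-cases (inj₁ y<x) = ⊥-elim (<-irrefl offsets-equal
        (proj₂ (proj₂ (critsOf-IsCritical (core n p δ) 1≤y y≤n y∈)) x y<x x≤hi))

  core-CriticallyMonotone : ∀ β → InU n β → Monotone-on β (critList n p β) → CriticallyMonotone n p (core n p β)
  core-CriticallyMonotone β U mono {u} {v} 1≤u v≤n u∈ v∈ u<v =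
    subst₂ _≤_ (sym (core-critical β u u≤n u∈β)) (sym (core-critical β v v≤n v∈β))
      (mono (critList⁺ 1≤n β 1≤u u≤n u∈β) (critList⁺ 1≤n β 1≤v v≤n v∈β) u<v)
    where
    u≤n = ≤-trans (<⇒≤ u<v) v≤n
    1≤v = ≤-trans 1≤u (<⇒≤ u<v)
    u∈β = core-critical⇒critical β U u 1≤u u≤n u∈
    v∈β = core-critical⇒critical β U v 1≤v v≤n v∈

module FloorFlag (n : ℕ) (p : ℕ → ℕ) (1≤n : 1 ≤ n) (γ : Tuple) (γ-upper : InU n γ)
                 (γ-critical-monotone : CriticallyMonotone n p γ) where
  open CarrelStructure n p
  open CoreFloor n p 1≤n

  lo≤floor : ∀ m → 1 ≤ m → m ≤ n → lo n p m ∈ R → (∀ {y} → y ∈ critsOf n p γ m → m ≤ y) →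
             γ (lo n p m) ≤ floor n p γ m
  lo≤floor m 1≤m m≤n lo∈R m≤crits = by-cases (isCrit n p γ m) refl
    where
    by-cases : ∀ b → isCrit n p γ m ≡ b → γ (lo n p m) ≤ floor n p γ m
    by-cases true crit = subst (γ (lo n p m) ≤_) (sym (floor-critical γ m m∈))
      (γ-critical-monotone (1≤∈R lo∈R) m≤n (∈R⇒critical γ lo∈R) m∈ (lo< m 1≤m))
      where m∈ = isCrit⇒∈ γ m (Equivalence.from T-≡ crit)
    by-cases false not-crit = subst (γ (lo n p m) ≤_) (sym (floor-special γ m not-crit special)) (m≤m⊔n _ _)
      where
      special : T (Special γ m)
      special = Equivalence.from T-∧ (<⇒<ᵇ (1≤∈R lo∈R) , ≡⇒≡ᵇ _ _ (nextCrit≡minCrit γ m m≤n m≤crits))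

  core≤floor-suc : ∀ k → 1 ≤ k → suc k ≤ hi n p k → core n p γ k ≤ floor n p γ (suc k)
  core≤floor-suc k 1≤k k<hi = ≤-trans (<⇒≤ (core-strict-in-carrel γ γ-upper k 1≤k k<hi))
                                      (core≤floor γ (suc k) (≤-trans k<hi (hi≤n k)))

  core≤floor-next-carrel : ∀ k → 1 ≤ k → k < n → hi n p k ≡ k → core n p γ k ≤ floor n p γ (suc k)
  core≤floor-next-carrel k 1≤k k<n hi≡k = subst (_≤ floor n p γ (suc k)) (sym ĉ≡γ)
    (subst (λ l → γ l ≤ floor n p γ (suc k)) (lo-suc-∈R k∈R)
      (lo≤floor (suc k) (s≤s z≤n) k<n (subst (_∈ R) (sym (lo-suc-∈R k∈R)) k∈R) after-k))
    where
    k∈R : k ∈ R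
    k∈R with hi-sel k
    ... | inj₁ hi≡n = ⊥-elim (<-irrefl (trans (sym hi≡k) hi≡n) k<n)
    ... | inj₂ (hi∈R , _) = subst (_∈ R) hi≡k hi∈R
    ĉ≡γ : core n p γ k ≡ γ k
    ĉ≡γ = core-critical γ k (<⇒≤ k<n) (∈R⇒critical γ k∈R)
    after-k : ∀ {y} → y ∈ critsOf n p γ (suc k) → suc k ≤ y
    after-k y∈ = subst (_< _) (lo-suc-∈R k∈R) (proj₁ (critsOf-IsCritical γ (s≤s z≤n) k<n y∈))

  floor-step : ∀ k → 1 ≤ k → k < n → floor n p γ k ≤ floor n p γ (suc k)
  floor-step k 1≤k k<n with floor-cases γ k (<⇒≤ k<n)
  ... | inj₁ φ≡ĉ with suc k ≤? hi n p k
  ...   | yes k<hi = subst (_≤ floor n p γ (suc k)) (sym φ≡ĉ) (core≤floor-suc k 1≤k k<hi)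
  ...   | no k≮hi = subst (_≤ floor n p γ (suc k)) (sym φ≡ĉ)
                      (core≤floor-next-carrel k 1≤k k<n (≤-antisym (≤-pred (≰⇒> k≮hi)) (≤hi k (<⇒≤ k<n))))
  floor-step k 1≤k k<n | inj₂ (not-crit , special , φ≡) =
    subst (_≤ floor n p γ (suc k)) (sym φ≡) (⊔-lub lo≤ (core≤floor-suc k 1≤k k<hi))
    where
    open IsNextCritical (nextCrit-spec γ k (<⇒≤ k<n))
    x = nextCrit n p γ k
    k<x : k < x
    k<x with m≤n⇒m<n∨m≡n k≤x
    ... | inj₁ k<x = k<x
    ... | inj₂ k≡x = ⊥-elim (subst T not-crit (Equivalence.from T-≡
            (∈⇒isCrit γ k (subst (_∈ critsOf n p γ k) (sym k≡x) critical))))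
    k<hi = ≤-trans k<x x≤hi
    same-carrel = critsOf-carrel γ k (suc k) (n≤1+n k) k<hi
    x≡min : x ≡ minCrit n p γ k
    x≡min = ≡ᵇ⇒≡ x _ (proj₂ (Equivalence.to T-∧ special))
    after-k : ∀ {y} → y ∈ critsOf n p γ (suc k) → suc k ≤ y
    after-k {y} y∈ = ≤-trans k<x (subst (_≤ y) (sym x≡min) (minCrit-least γ k (subst (y ∈_) same-carrel y∈)))
    lo≤ : γ (lo n p k) ≤ floor n p γ (suc k)
    lo≤ = subst (λ l → γ l ≤ floor n p γ (suc k)) (lo-carrel k (suc k) (n≤1+n k) k<hi)
            (lo≤floor (suc k) (s≤s z≤n) k<n
              (subst (_∈ R) (sym (lo-carrel k (suc k) (n≤1+n k) k<hi)) (Special⇒lo∈R γ k special)) after-k)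

  floor-upper : InU n (floor n p γ)
  floor-upper k 1≤k k≤n = ≤-trans k≤ĉ (core≤floor γ k k≤n) , floor≤n
    where
    k≤ĉ = proj₁ (core-upper γ γ-upper k 1≤k k≤n)
    ĉ≤n = proj₂ (core-upper γ γ-upper k 1≤k k≤n)
    floor≤n : floor n p γ k ≤ n
    floor≤n with floor-cases γ k k≤n
    ... | inj₁ eq = subst (_≤ n) (sym eq) ĉ≤n
    ... | inj₂ (_ , special , eq) = subst (_≤ n) (sym eq)
      (⊔-lub (proj₂ (γ-upper _ (1≤∈R lo∈R) (<⇒≤ (<n∈R lo∈R)))) ĉ≤n)
      where lo∈R = Special⇒lo∈R γ k special

  floor-flag : InUF n (floor n p γ)
  floor-flag = floor-upper , floor-step

-- Agreement at critical indices

-- At a critical u the offset of β attains its minimum over [u, b] only at u, and fits at rows u and u + 1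
-- detect exactly this.
Fits⇔⇒critical-entry : ∀ {β φ a b u} →
  (∀ {i v} → 1 ≤ i → i ≤ b → Fits β i b v → Fits φ i b v) →
  (∀ {i v} → 1 ≤ i → i ≤ b → Fits φ i b v → Fits β i b v) →
  1 ≤ u → IsCritical β a b u → β u ≡ φ u
Fits⇔⇒critical-entry {β} {φ} {a} {b} {u} β⇒φ φ⇒β 1≤u crit@(_ , u≤b , below) =
  ≤-antisym (Fits⇒≤ (β⇒φ 1≤u u≤b fits-β) u≤b) φu≤βu
  where
  fits-β : Fits β u b (β u)
  fits-β k u≤k k≤b = IsCritical⇒Offset≤ crit u≤k k≤b
  φu≤βu : φ u ≤ β u
  φu≤βu with φ u ≤? β u
  ... | yes φu≤βu = φu≤βu
  ... | no φu≰βu = ⊥-elim (<-irrefl refl (Fits⇒≤ (φ⇒β 1≤u u≤b fits-φ) u≤b))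
    where
    fits-φ : Fits φ u b (suc (β u))
    fits-φ k u≤k k≤b with m≤n⇒m<n∨m≡n u≤k
    ... | inj₂ refl = +-monoˡ-≤ u (≰⇒> φu≰βu)
    ... | inj₁ u<k = ≤-pred (subst (suc (suc (β u) + k) ≤_) (+-suc (φ k) u)
                                 (β⇒φ (s≤s z≤n) (≤-trans u<k k≤b) fits-below k u<k k≤b))
      where
      fits-below : Fits β (suc u) b (suc (suc (β u)))
      fits-below l u<l l≤b = subst (suc (suc (β u) + l) ≤_) (sym (+-suc (β l) u)) (s≤s (below l u<l l≤b))

critical-in-last-carrel : ∀ {n β a u} → InU n β → 1 ≤ u → IsCritical β a n u → u ≡ n
critical-in-last-carrel {n} {β} {u = u} U 1≤u (_ , u≤n , below) with m≤n⇒m<n∨m≡n u≤n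
... | inj₂ u≡n = u≡n
... | inj₁ u<n = ⊥-elim (<⇒≱ βu<u (proj₁ (U u 1≤u u≤n)))
  where
  βu<u : β u < u
  βu<u = +-cancelʳ-< n (β u) u (<-≤-trans (below n u<n ≤-refl)
           (≤-trans (+-monoˡ-≤ u (proj₂ (U n (≤-trans 1≤u u≤n) ≤-refl))) (≤-reflexive (+-comm n u))))

InUF⇒monotone : ∀ {n φ} → InUF n φ → ∀ {u v} → 1 ≤ u → u ≤ v → v ≤ n → φ u ≤ φ v
InUF⇒monotone {φ = φ} (_ , step) {u} 1≤u u≤v v≤n with m≤n⇒∃[o]m+o≡n u≤v
... | d , refl = go d v≤n
  where
  go : ∀ d → u + d ≤ _ → φ u ≤ φ (u + d)
  go zero _ rewrite +-identityʳ u = ≤-refl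
  go (suc d) u+d<n rewrite +-suc u d =
    ≤-trans (go d (≤-trans (n≤1+n _) u+d<n)) (step (u + d) (≤-trans 1≤u (m≤m+n u d)) u+d<n)

module _ {n p} (isP : IsPartition n p) (1≤n : 1 ≤ n) where
  open CarrelStructure n p
  open CoreFloor n p 1≤n

  colLen-IsCarrelEnd : ∀ {j i} → InShape n p j i → IsCarrelEnd (colLen n p j)
  colLen-IsCarrelEnd {j} sh@(1≤i , _ , 1≤j , _) with m≤n⇒m<n∨m≡n (colLen≤n n p j)
  ... | inj₂ c≡n = inj₁ c≡n
  ... | inj₁ c<n = inj₂ (∈R⁺ 1≤c c<n (j , 1≤j , ≤colLen⇒≤p isP ≤-refl 1≤c , refl))
    where 1≤c = ≤-trans 1≤i (InShape⇒≤colLen isP {j} sh)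

  floor-core-SameS : ∀ β → InU n β → SameS n p β (floor n p (core n p β))
  floor-core-SameS β U T = FitsImplies⇒SubS isP forward T , FitsImplies⇒SubS isP backward T
    where
    γ = core n p β
    γ-upper = core-upper β U
    forward : FitsImplies n p β (floor n p γ)
    forward j i sh v = Fits-floor⁺ γ (IsCarrelEnd⇒≤n end) ∘ Fits-core⁺ γ γ-upper end 1≤i ∘ Fits-core⁺ β U end 1≤i
      where
      end = colLen-IsCarrelEnd sh
      1≤i = proj₁ sh
    backward : FitsImplies n p (floor n p γ) β
    backward j i sh v = Fits-core⁻ β U c≤n 1≤i ∘ Fits-core⁻ γ γ-upper c≤n 1≤i ∘ Fits-floor⁻ γ γ-upper end 1≤i
      where
      end = colLen-IsCarrelEnd sh
      c≤n = IsCarrelEnd⇒≤n end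
      1≤i = proj₁ sh

  column-Fits : ∀ {β φ} → InU n β → SubS n p β φ → ∀ {j b} → 1 ≤ j → colLen n p j ≡ b →
                ∀ {i v} → 1 ≤ i → i ≤ b → Fits β i b v → Fits φ i b v
  column-Fits U sub {j} 1≤j refl 1≤i i≤b = SubS⇒FitsImplies isP U sub j _ (≤colLen⇒InShape isP 1≤j 1≤i i≤b) _

  SameS⇒critical-entry : ∀ {β φ} → InU n β → InU n φ → SameS n p β φ → ∀ {u} → u ∈ critList n p β → β u ≡ φ u
  SameS⇒critical-entry {β} {φ} Uβ Uφ same {u} u∈ with critList⁻ 1≤n β u∈
  ... | 1≤u , u≤n , u∈crits with critsOf-IsCritical β 1≤u u≤n u∈crits | hi-sel u
  ...   | crit | inj₁ hi≡n
    rewrite critical-in-last-carrel Uβ 1≤u (subst (λ b → IsCritical β (lo n p u) b u) hi≡n crit) =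
    trans (≤-antisym (proj₂ (Uβ n 1≤n ≤-refl)) (proj₁ (Uβ n 1≤n ≤-refl)))
          (sym (≤-antisym (proj₂ (Uφ n 1≤n ≤-refl)) (proj₁ (Uφ n 1≤n ≤-refl))))
  ...   | crit | inj₂ (hi∈R , _) with ∈R⁻ hi∈R
  ...     | _ , _ , j , 1≤j , _ , colLen≡hi = Fits⇔⇒critical-entry
            (column-Fits Uβ (proj₁ ∘ same) 1≤j colLen≡hi) (column-Fits Uφ (proj₂ ∘ same) 1≤j colLen≡hi) 1≤u crit

  flag-SameS⇒Monotone-on : ∀ {β φ} → InU n β → InUF n φ → SameS n p β φ → Monotone-on β (critList n p β)
  flag-SameS⇒Monotone-on {β} Uβ flag@(Uφ , _) same u∈ v∈ u<v =
    subst₂ _≤_ (sym (SameS⇒critical-entry Uβ Uφ same u∈)) (sym (SameS⇒critical-entry Uβ Uφ same v∈))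
      (InUF⇒monotone flag (proj₁ (critList⁻ 1≤n β u∈)) (<⇒≤ u<v) (proj₁ (proj₂ (critList⁻ 1≤n β v∈))))

proposition8p1 : (n : ℕ) → 1 ≤ n → (p : ℕ → ℕ) → IsPartition n p →
    (β : Tuple) → InU n β →
    ((∃ λ φ → InUF n φ × SameS n p β φ) → InUGC n p β) ×
    (InUGC n p β → ∃ λ φ → InUF n φ × SameS n p β φ) ×
    (InUGC n p β → SameS n p β (floor n p (core n p β)))
proposition8p1 n 1≤n p isP β U = necessity , sufficiency , λ _ → floor-core-SameS isP 1≤n β U
  where
  sorted = CarrelStructure.critList-increasing n p 1≤n β

  necessity : (∃ λ φ → InUF n φ × SameS n p β φ) → InUGC n p β
  necessity (φ , flag , same) = U , Monotone-on⇒Linked-map β sorted (flag-SameS⇒Monotone-on isP 1≤n U flag same)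

  sufficiency : InUGC n p β → ∃ λ φ → InUF n φ × SameS n p β φ
  sufficiency (_ , linked) = floor n p (core n p β) ,
    FloorFlag.floor-flag n p 1≤n (core n p β) (CoreFloor.core-upper n p 1≤n β U)
      (CoreFloor.core-CriticallyMonotone n p 1≤n β U (Linked-map⇒Monotone-on β sorted linked)) ,
    floor-core-SameS isP 1≤n β U
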